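{- Let $n\ge 2$ and $a_1,\ldots,a_{n-1}$ be positive integers, and suppose $$?([a_1,a_2,\ldots,a_{n-1}])=[b_1,b_2,\ldots,b_k],\qquad b_k\neq 1,$$ with $b_1,\ldots,b_k$ positive integers. Let $s\in\mathbb{Z}_+$ and $a_n=\sum_{i=1}^{n-1}a_i+s$. Let $c_1,\ldots,c_m$ ($m\ge1$) be arbitrary positive integers and consider the number $\gamma=[a_1,\ldots,a_n,c_1,\ldots,c_m]$. Then there exist an integer $z$ with $$2^{s+1}-1\le z\le 2^{s+2}-1$$ and a finite sequence of positive integers $(b_{k+2},\ldots,b_p)$ such that: 1. if $n\equiv k \pmod 2$, then $?(\gamma)=[b_1,\ldots,b_{k-1},b_k-1,1,z,b_{k+2},\ldots,b_p]$; 2. if $n\equiv k+1 \pmod 2$, then $?(\gamma)=[b_1,\ldots,b_k,z,b_{k+2},\ldots,b_p]$.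
   Context: $\mathbb{Z}_+$ denotes the positive integers. $[a_1,\ldots,a_t]=\cfrac{1}{a_1+\cfrac{1}{a_2+\cdots+\cfrac{1}{a_t}}}$ denotes a finite continued fraction with positive integer partial quotients. The Minkowski question mark function $?:[0,1]\to[0,1]$ is given for irrational $x=[a_1,a_2,\ldots]$ by $?(x)=\sum_{k=1}^{\infty}\frac{(-1)^{k+1}}{2^{a_1+\cdots+a_k-1}}$, and for rational $x$ by $?([a_1,\ldots,a_t+1])=?([a_1,\ldots,a_t,1])=\sum_{k=1}^{t}\frac{(-1)^{k+1}}{2^{a_1+\cdots+a_k-1}}$; it is continuous and strictly increasing. -}

module Defs where

open import Data.Nat as ℕ using (ℕ; zero; suc)
open import Data.List using (List; []; _∷_)
open import Data.Rational using (ℚ; 0ℚ; 1ℚ; ½; _+_; _*_; -_; 1/_; ≢-nonZero; _≟_)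
import Data.Rational as ℚ
import Data.Integer as ℤ
open import Relation.Nullary using (yes; no)

-- Reciprocal, made total by sending 0 to 0 (never used at 0 for positive
-- partial quotients).
inv : ℚ → ℚ
inv p with p ≟ 0ℚ
... | yes _  = 0ℚ
... | no p≢0 = 1/_ p {{≢-nonZero p≢0}}

-- Value of the finite continued fraction
-- [a₁,…,a_t] = 1/(a₁ + 1/(a₂ + ⋯ + 1/a_t)).
-- (cf [] = 0 by convention; only used on nonempty lists.)
cf : List ℕ → ℚ
cf []      = 0ℚ
cf (a ∷ r) = inv ((ℤ.+ a ℚ./ 1) + cf r)

halfPow : ℕ → ℚ
halfPow zero    = 1ℚ
halfPow (suc e) = ½ * halfPow e

-- alt S σ [a_j,…,a_t] = Σ_{k=j}^{t} σ_k / 2^{S + a_j + ⋯ + a_k - 1},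
-- signs alternating starting from σ.
alt : ℕ → ℚ → List ℕ → ℚ
alt S σ []      = 0ℚ
alt S σ (a ∷ r) = σ * halfPow ((S ℕ.+ a) ℕ.∸ 1) + alt (S ℕ.+ a) (- σ) r

-- Minkowski question mark function of the rational [a₁,…,a_t]:
-- ?([a₁,…,a_t]) = Σ_{k=1}^{t} (-1)^{k+1} / 2^{a₁+⋯+a_k-1}.
mink : List ℕ → ℚ
mink l = alt 0 1ℚ l

{-# OPTIONS --safe #-}
-- Let L be [b₁,…,b_k] or [b₁,…,b_k − 1, 1], whichever has the parity of n − 1,
-- and let [[α,β],[γ,δ]] be its convergent matrix: then x = ?([a₁,…,a_{n−1}]) = β/δ
-- and αδ − βγ = ±1 has the sign σ of the next term of the series for ?.
-- Since x = m/2^{A−1} with m odd (A = a₁ + ⋯ + a_{n−1}), unimodularity forces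
-- δ = 2^{A−1}. Appending a_n = A + s and the c's adds σ 2^{−(2A+s)} (2 − μ) to ?,
-- where μ = ?([c₁,…,c_m]) ∈ (0,1]. Solving for the complete quotient W with
-- ?([a₁,…,a_n,c₁,…,c_m]) = (α + βW)/(γ + δW) gives W = 2^{s+2}/(2 − μ) − γ/δ,
-- which lies in (2^{s+1} − 1, 2^{s+2}]; writing W = z + [rest] with
-- 0 < [rest] ≤ 1 yields the new partial quotient z.
module Submission where

open import Defs

module ContinuedFractions where

  open import Data.Empty using (⊥-elim)
  import Data.Integer as ℤ
  import Data.Integer.Properties as ℤP
  open import Data.List using (List; []; _∷_; _++_; length; [_])
  open import Data.List.Properties using (++-identityʳ)
  open import Data.List.Relation.Unary.All using (All; []; _∷_)
  open import Data.List.Relation.Unary.All.Properties using (++⁺)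
  open import Data.Nat as ℕ using (ℕ; zero; suc; _≤_; _<_; _^_; _∸_; z≤n; s≤s)
  open import Data.Nat.Coprimality as Coprime using (Coprime)
  open import Data.Nat.Divisibility using (_∣_; divides; ∣-trans; ∣⇒≤; 0∣⇒≡0; ∣1⇒≡1; ∣m+n∣m⇒∣n)
  open import Data.Nat.DivMod using (_/_; _%_; m≡m%n+[m/n]*n; m%n<n; [m+n]%n≡m%n)
  open import Data.Nat.Induction using (<-wellFounded)
  open import Data.Nat.ListAction using (sum)
  import Data.Nat.Properties as ℕP
  import Data.Nat.Solver as ℕSolver
  open import Data.Product using (∃-syntax; _×_; _,_; proj₁; proj₂)
  open import Data.Rational as ℚ using (ℚ; 0ℚ; 1ℚ; ½; mkℚ; _+_; _*_; _-_; -_; _≟_)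
  import Data.Rational.Properties as ℚP
  open import Data.Rational.Solver using (module +-*-Solver)
  open import Data.Sum using (_⊎_; inj₁; inj₂)
  open import Induction.WellFounded using (Acc; acc)
  open import Relation.Binary.PropositionalEquality
    using (_≡_; _≢_; refl; sym; trans; cong; cong₂; subst; subst₂; module ≡-Reasoning)
  open import Relation.Nullary using (¬_; yes; no)

  open +-*-Solver
  open ℕSolver.+-*-Solver using ()
    renaming (solve to ℕsolve; _:=_ to _:=ℕ_; _:+_ to _:+ℕ_; _:*_ to _:*ℕ_; con to conℕ)

  ι : ℕ → ℚ
  ι n = ℤ.+ n ℚ./ 1

  ι≡mkℚ : ∀ n → ι n ≡ mkℚ (ℤ.+ n) 0 (Coprime.sym (Coprime.1-coprimeTo n))
  ι≡mkℚ n = ℚP.normalize-coprime (Coprime.sym (Coprime.1-coprimeTo n))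

  ι-+ : ∀ m n → ι (m ℕ.+ n) ≡ ι m + ι n
  ι-+ m n = trans (cong (ℚ._/ 1) (sym (cong₂ ℤ._+_ (ℤP.*-identityʳ (ℤ.+ m)) (ℤP.*-identityʳ (ℤ.+ n)))))
                  (sym (cong₂ _+_ (ι≡mkℚ m) (ι≡mkℚ n)))

  ι-* : ∀ m n → ι (m ℕ.* n) ≡ ι m * ι n
  ι-* m n = trans (cong (ℚ._/ 1) (ℤP.pos-* m n)) (sym (cong₂ _*_ (ι≡mkℚ m) (ι≡mkℚ n)))

  ι-suc : ∀ n → ι (suc n) ≡ ι n + 1ℚ
  ι-suc n = trans (cong ι (ℕP.+-comm 1 n)) (ι-+ n 1)

  ι-*-+ : ∀ a b c → ι (a ℕ.* b ℕ.+ c) ≡ ι a * ι b + ι c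
  ι-*-+ a b c = trans (ι-+ (a ℕ.* b) c) (cong (_+ ι c) (ι-* a b))

  ι-+-* : ∀ a b c → ι (a ℕ.+ b ℕ.* c) ≡ ι a + ι b * ι c
  ι-+-* a b c = trans (ι-+ a (b ℕ.* c)) (cong (ι a +_) (ι-* b c))

  ι-*-* : ∀ a b c → ι (a ℕ.* b ℕ.* c) ≡ ι a * ι b * ι c
  ι-*-* a b c = trans (ι-* (a ℕ.* b) c) (cong (_* ι c) (ι-* a b))

  ι-∸ : ∀ {m n} → n ≤ m → ι (m ∸ n) ≡ ι m - ι n
  ι-∸ {m} {n} n≤m = begin
    ι (m ∸ n)                ≡⟨ solve 2 (λ x y → x := x :+ y :- y) refl (ι (m ∸ n)) (ι n) ⟩
    ι (m ∸ n) + ι n - ι n    ≡⟨ cong (_- ι n) (ι-+ (m ∸ n) n) ⟨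
    ι (m ∸ n ℕ.+ n) - ι n    ≡⟨ cong (λ k → ι k - ι n) (ℕP.m∸n+n≡m n≤m) ⟩
    ι m - ι n                ∎
    where open ≡-Reasoning

  ι-injective : ∀ {m n} → ι m ≡ ι n → m ≡ n
  ι-injective {m} {n} eq rewrite ι≡mkℚ m | ι≡mkℚ n = ℤP.+-injective (cong ℚ.ℚ.numerator eq)

  ι-mono-< : ∀ {m n} → m < n → ι m ℚ.< ι n
  ι-mono-< {m} {n} m<n = subst₂ ℚ._<_ (sym (ι≡mkℚ m)) (sym (ι≡mkℚ n))
    (ℚ.*<* (subst₂ ℤ._<_ (sym (ℤP.*-identityʳ _)) (sym (ℤP.*-identityʳ _)) (ℤ.+<+ m<n)))

  ι-mono-≤ : ∀ {m n} → m ≤ n → ι m ℚ.≤ ι n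
  ι-mono-≤ {m} {n} m≤n = subst₂ ℚ._≤_ (sym (ι≡mkℚ m)) (sym (ι≡mkℚ n))
    (ℚ.*≤* (subst₂ ℤ._≤_ (sym (ℤP.*-identityʳ _)) (sym (ℤP.*-identityʳ _)) (ℤ.+≤+ m≤n)))

  ι-nonNeg : ∀ n → 0ℚ ℚ.≤ ι n
  ι-nonNeg n = ι-mono-≤ {0} {n} z≤n

  pos⇒≢0 : ∀ {p} → 0ℚ ℚ.< p → p ≢ 0ℚ
  pos⇒≢0 p>0 p≡0 = ℚP.<⇒≢ p>0 (sym p≡0)

  pos*pos⇒pos : ∀ {p q} → 0ℚ ℚ.< p → 0ℚ ℚ.< q → 0ℚ ℚ.< p * q
  pos*pos⇒pos {p} {q} p>0 q>0 =
    ℚP.positive⁻¹ (p * q) {{ℚP.pos*pos⇒pos p {{ℚ.positive p>0}} q {{ℚ.positive q>0}}}}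

  inv-inverseʳ : ∀ p → p ≢ 0ℚ → p * inv p ≡ 1ℚ
  inv-inverseʳ p p≢0 with p ≟ 0ℚ
  ... | yes p≡0  = ⊥-elim (p≢0 p≡0)
  ... | no  p≢0′ = ℚP.*-inverseʳ p {{ℚ.≢-nonZero p≢0′}}

  inv-inverseˡ : ∀ p → p ≢ 0ℚ → inv p * p ≡ 1ℚ
  inv-inverseˡ p p≢0 = trans (ℚP.*-comm (inv p) p) (inv-inverseʳ p p≢0)

  inv-nonNeg : ∀ p → 0ℚ ℚ.≤ p → 0ℚ ℚ.≤ inv p
  inv-nonNeg p p≥0 with p ≟ 0ℚ
  ... | yes _   = ℚP.≤-refl
  ... | no  p≢0 = ℚP.<⇒≤ (ℚP.positive⁻¹ _ {{ℚP.1/pos⇒pos p {{p>0}}}})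
    where
    p>0 : ℚ.Positive p
    p>0 = ℚP.nonNeg∧nonZero⇒pos p {{ℚ.nonNegative p≥0}} {{ℚ.≢-nonZero p≢0}}

  inv-cancelˡ : ∀ {p} q → p ≢ 0ℚ → inv p * (p * q) ≡ q
  inv-cancelˡ {p} q p≢0 = begin
    inv p * (p * q)  ≡⟨ ℚP.*-assoc (inv p) p q ⟨
    inv p * p * q    ≡⟨ cong (_* q) (inv-inverseˡ p p≢0) ⟩
    1ℚ * q           ≡⟨ ℚP.*-identityˡ q ⟩
    q                ∎
    where open ≡-Reasoning

  *-cancelʳ-≢0 : ∀ {a b c} → c ≢ 0ℚ → a * c ≡ b * c → a ≡ b
  *-cancelʳ-≢0 {a} {b} {c} c≢0 eq = begin
    a                ≡⟨ trans (cong (a *_) (inv-inverseʳ c c≢0)) (ℚP.*-identityʳ a) ⟨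
    a * (c * inv c)  ≡⟨ ℚP.*-assoc a c (inv c) ⟨
    a * c * inv c    ≡⟨ cong (_* inv c) eq ⟩
    b * c * inv c    ≡⟨ ℚP.*-assoc b c (inv c) ⟩
    b * (c * inv c)  ≡⟨ trans (cong (b *_) (inv-inverseʳ c c≢0)) (ℚP.*-identityʳ b) ⟩
    b                ∎
    where open ≡-Reasoning

  -- Continued fractions and their matrices

  cf-nonNeg : ∀ l → 0ℚ ℚ.≤ cf l
  cf-nonNeg []      = ℚP.≤-refl
  cf-nonNeg (a ∷ l) = inv-nonNeg _ (ℚP.+-mono-≤ (ι-nonNeg a) (cf-nonNeg l))

  quotient-pos : ∀ {z} → 1 ≤ z → ∀ rest → 0ℚ ℚ.< ι z + cf rest
  quotient-pos 1≤z rest = ℚP.+-mono-<-≤ (ι-mono-< 1≤z) (cf-nonNeg rest)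

  sign : ℕ → ℚ
  sign zero    = 1ℚ
  sign (suc n) = - sign n

  sign-cases : ∀ n → sign n ≡ 1ℚ ⊎ sign n ≡ - 1ℚ
  sign-cases zero = inj₁ refl
  sign-cases (suc n) with sign-cases n
  ... | inj₁ eq = inj₂ (cong -_ eq)
  ... | inj₂ eq = inj₁ (cong -_ eq)

  record Matrix : Set where
    constructor matrix
    field α β γ δ : ℕ

  -- The product of the matrices [[0,1],[1,a]] over the list.
  cfMatrix : List ℕ → Matrix
  cfMatrix []      = matrix 1 0 0 1
  cfMatrix (a ∷ l) = matrix γ′ δ′ (a ℕ.* γ′ ℕ.+ α′) (a ℕ.* δ′ ℕ.+ β′)
    where open Matrix (cfMatrix l) renaming (α to α′; β to β′; γ to γ′; δ to δ′)

  cf-++ : ∀ {L} → All (1 ≤_) L → ∀ R → let open Matrix (cfMatrix L) in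
          cf (L ++ R) * (ι γ * cf R + ι δ) ≡ ι α * cf R + ι β
  cf-++ [] R = solve 1 (λ r → r :* (con 0ℚ :* r :+ con 1ℚ) := con 1ℚ :* r :+ con 0ℚ) refl (cf R)
  cf-++ {a ∷ L} (1≤a ∷ L⁺) R = begin
    inv (ι a + C) * (ι (a ℕ.* γ ℕ.+ α) * r + ι (a ℕ.* δ ℕ.+ β))  ≡⟨ cong (inv (ι a + C) *_) numerator ⟩
    inv (ι a + C) * ((ι a + C) * Y)                              ≡⟨ inv-cancelˡ Y (pos⇒≢0 (quotient-pos 1≤a (L ++ R))) ⟩
    Y                                                            ∎
    where
    open ≡-Reasoning
    open Matrix (cfMatrix L)
    C = cf (L ++ R)
    r = cf R
    Y = ι γ * r + ι δ
    numerator : ι (a ℕ.* γ ℕ.+ α) * r + ι (a ℕ.* δ ℕ.+ β) ≡ (ι a + C) * Y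
    numerator = begin
      ι (a ℕ.* γ ℕ.+ α) * r + ι (a ℕ.* δ ℕ.+ β)
        ≡⟨ cong₂ (λ u v → u * r + v) (ι-*-+ a γ α) (ι-*-+ a δ β) ⟩
      (ι a * ι γ + ι α) * r + (ι a * ι δ + ι β)
        ≡⟨ solve 6 (λ A G AL R D B → (A :* G :+ AL) :* R :+ (A :* D :+ B)
                                     := A :* (G :* R :+ D) :+ (AL :* R :+ B))
                 refl (ι a) (ι γ) (ι α) r (ι δ) (ι β) ⟩
      ι a * Y + (ι α * r + ι β)
        ≡⟨ cong (ι a * Y +_) (cf-++ L⁺ R) ⟨
      ι a * Y + C * Y
        ≡⟨ ℚP.*-distribʳ-+ Y (ι a) C ⟨
      (ι a + C) * Y
        ∎

  cf-++-∷ : ∀ {L} → All (1 ≤_) L → ∀ {z} → 1 ≤ z → ∀ rest →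
            let open Matrix (cfMatrix L); W = ι z + cf rest in
            cf (L ++ z ∷ rest) * (ι γ + ι δ * W) ≡ ι α + ι β * W
  cf-++-∷ {L} L⁺ {z} 1≤z rest = begin
    C * (ι γ + ι δ * W)              ≡⟨ cong (λ u → C * (u + ι δ * W)) γ≡γ*r*W ⟩
    C * (ι γ * (r * W) + ι δ * W)    ≡⟨ solve 5 (λ C G r W D → C :* (G :* (r :* W) :+ D :* W) := C :* (G :* r :+ D) :* W)
                                              refl C (ι γ) r W (ι δ) ⟩
    C * (ι γ * r + ι δ) * W          ≡⟨ cong (_* W) (cf-++ L⁺ (z ∷ rest)) ⟩
    (ι α * r + ι β) * W              ≡⟨ solve 4 (λ A r W B → (A :* r :+ B) :* W := A :* (r :* W) :+ B :* W)
                                              refl (ι α) r W (ι β) ⟩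
    ι α * (r * W) + ι β * W          ≡⟨ cong (λ u → ι α * u + ι β * W) r*W≡1 ⟩
    ι α * 1ℚ + ι β * W               ≡⟨ cong (_+ ι β * W) (ℚP.*-identityʳ (ι α)) ⟩
    ι α + ι β * W                    ∎
    where
    open ≡-Reasoning
    open Matrix (cfMatrix L)
    W = ι z + cf rest
    r = inv W
    C = cf (L ++ z ∷ rest)
    r*W≡1 : r * W ≡ 1ℚ
    r*W≡1 = inv-inverseˡ W (pos⇒≢0 (quotient-pos 1≤z rest))
    γ≡γ*r*W : ι γ ≡ ι γ * (r * W)
    γ≡γ*r*W = sym (trans (cong (ι γ *_) r*W≡1) (ℚP.*-identityʳ (ι γ)))

  cf*δ≡β : ∀ {L} → All (1 ≤_) L → let open Matrix (cfMatrix L) in cf L * ι δ ≡ ι β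
  cf*δ≡β {L} L⁺ = begin
    cf L * ι δ                       ≡⟨ cong (λ l → cf l * ι δ) (++-identityʳ L) ⟨
    cf (L ++ []) * ι δ               ≡⟨ solve 3 (λ c g d → c :* d := c :* (g :* con 0ℚ :+ d))
                                                refl (cf (L ++ [])) (ι γ) (ι δ) ⟩
    cf (L ++ []) * (ι γ * 0ℚ + ι δ)  ≡⟨ cf-++ L⁺ [] ⟩
    ι α * 0ℚ + ι β                   ≡⟨ solve 2 (λ a b → a :* con 0ℚ :+ b := b) refl (ι α) (ι β) ⟩
    ι β                              ∎
    where
    open ≡-Reasoning
    open Matrix (cfMatrix L)

  cfMatrix-det : ∀ L → let open Matrix (cfMatrix L) in ι α * ι δ - ι β * ι γ ≡ sign (length L)
  cfMatrix-det []      = refl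
  cfMatrix-det (a ∷ L) = begin
    ι γ * ι (a ℕ.* δ ℕ.+ β) - ι δ * ι (a ℕ.* γ ℕ.+ α)
      ≡⟨ cong₂ (λ u v → ι γ * u - ι δ * v) (ι-*-+ a δ β) (ι-*-+ a γ α) ⟩
    ι γ * (ι a * ι δ + ι β) - ι δ * (ι a * ι γ + ι α)
      ≡⟨ solve 5 (λ G A D B AL → G :* (A :* D :+ B) :- D :* (A :* G :+ AL) := :- (AL :* D :- B :* G))
               refl (ι γ) (ι a) (ι δ) (ι β) (ι α) ⟩
    - (ι α * ι δ - ι β * ι γ)
      ≡⟨ cong -_ (cfMatrix-det L) ⟩
    - sign (length L)
      ∎
    where
    open ≡-Reasoning
    open Matrix (cfMatrix L)

  Unimodular : ℕ → ℕ → ℕ → ℕ → Set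
  Unimodular α β γ δ = α ℕ.* δ ≡ β ℕ.* γ ℕ.+ 1 ⊎ β ℕ.* γ ≡ α ℕ.* δ ℕ.+ 1

  cfMatrix-unimodular : ∀ L → let open Matrix (cfMatrix L) in Unimodular α β γ δ
  cfMatrix-unimodular L with sign-cases (length L)
  ... | inj₁ det≡1 = inj₁ (ι-injective (begin
    ι (α ℕ.* δ)                          ≡⟨ ι-* α δ ⟩
    ι α * ι δ                            ≡⟨ solve 2 (λ X Y → X := (X :- Y) :+ Y) refl (ι α * ι δ) (ι β * ι γ) ⟩
    (ι α * ι δ - ι β * ι γ) + ι β * ι γ  ≡⟨ cong₂ _+_ (trans (cfMatrix-det L) det≡1) (sym (ι-* β γ)) ⟩
    1ℚ + ι (β ℕ.* γ)                     ≡⟨ ℚP.+-comm 1ℚ (ι (β ℕ.* γ)) ⟩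
    ι (β ℕ.* γ) + ι 1                    ≡⟨ ι-+ (β ℕ.* γ) 1 ⟨
    ι (β ℕ.* γ ℕ.+ 1)                    ∎))
    where
    open ≡-Reasoning
    open Matrix (cfMatrix L)
  ... | inj₂ det≡-1 = inj₂ (ι-injective (begin
    ι (β ℕ.* γ)                          ≡⟨ ι-* β γ ⟩
    ι β * ι γ                            ≡⟨ solve 2 (λ X Y → Y := X :- (X :- Y)) refl (ι α * ι δ) (ι β * ι γ) ⟩
    ι α * ι δ - (ι α * ι δ - ι β * ι γ)  ≡⟨ cong₂ _-_ (sym (ι-* α δ)) (trans (cfMatrix-det L) det≡-1) ⟩
    ι (α ℕ.* δ) - - 1ℚ                   ≡⟨ solve 1 (λ X → X :- (:- con 1ℚ) := X :+ con 1ℚ) refl (ι (α ℕ.* δ)) ⟩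
    ι (α ℕ.* δ) + ι 1                    ≡⟨ ι-+ (α ℕ.* δ) 1 ⟨
    ι (α ℕ.* δ ℕ.+ 1)                    ∎))
    where
    open ≡-Reasoning
    open Matrix (cfMatrix L)

  δ-mono-∷ : ∀ {a} L → 1 ≤ a → Matrix.δ (cfMatrix L) ≤ Matrix.δ (cfMatrix (a ∷ L))
  δ-mono-∷ {suc a} L _ = ℕP.≤-trans (ℕP.m≤n*m δ (suc a)) (ℕP.m≤m+n (suc a ℕ.* δ) β)
    where open Matrix (cfMatrix L)

  1≤δ : ∀ {L} → All (1 ≤_) L → 1 ≤ Matrix.δ (cfMatrix L)
  1≤δ []                 = s≤s z≤n
  1≤δ {_ ∷ L} (1≤a ∷ L⁺) = ℕP.≤-trans (1≤δ L⁺) (δ-mono-∷ L 1≤a)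

  γ≤δ : ∀ {L} → All (1 ≤_) L → Matrix.γ (cfMatrix L) ≤ Matrix.δ (cfMatrix L)
  γ≤δ []                             = z≤n
  γ≤δ {a ∷ []} (1≤a ∷ [])            = subst₂ _≤_ (sym (cong (ℕ._+ 1) (ℕP.*-zeroʳ a)))
                                          (sym (trans (ℕP.+-identityʳ (a ℕ.* 1)) (ℕP.*-identityʳ a))) 1≤a
  γ≤δ {a ∷ _ ∷ _} (_ ∷ L⁺@(_ ∷ L′⁺)) = ℕP.+-mono-≤ (ℕP.*-monoʳ-≤ a (γ≤δ L⁺)) (γ≤δ L′⁺)

  -- Dyadic values of the question mark function

  halfPow-*-2^ : ∀ e → halfPow e * ι (2 ^ e) ≡ 1ℚ
  halfPow-*-2^ zero    = refl
  halfPow-*-2^ (suc e) = begin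
    ½ * halfPow e * ι (2 ℕ.* 2 ^ e)     ≡⟨ cong (½ * halfPow e *_) (ι-* 2 (2 ^ e)) ⟩
    ½ * halfPow e * (ι 2 * ι (2 ^ e))   ≡⟨ solve 4 (λ h H t T → (h :* H) :* (t :* T) := (h :* t) :* (H :* T))
                                                 refl ½ (halfPow e) (ι 2) (ι (2 ^ e)) ⟩
    ½ * ι 2 * (halfPow e * ι (2 ^ e))   ≡⟨ cong (½ * ι 2 *_) (halfPow-*-2^ e) ⟩
    1ℚ                                  ∎
    where open ≡-Reasoning

  halfPow-+ : ∀ m n → halfPow (m ℕ.+ n) ≡ halfPow m * halfPow n
  halfPow-+ zero    n = sym (ℚP.*-identityˡ (halfPow n))
  halfPow-+ (suc m) n = trans (cong (½ *_) (halfPow-+ m n)) (sym (ℚP.*-assoc ½ (halfPow m) (halfPow n)))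

  halfPow-*-2^-square : ∀ j s →
    halfPow (suc j ℕ.+ (suc j ℕ.+ s)) * ι (2 ^ j) * ι (2 ^ j) * ι (2 ^ (s ℕ.+ 2)) ≡ 1ℚ
  halfPow-*-2^-square j s = begin
    K * ι (2 ^ j) * ι (2 ^ j) * ι (2 ^ (s ℕ.+ 2))     ≡⟨ solve 4 (λ K a b c → K :* a :* b :* c := K :* (a :* b :* c))
                                                                refl K (ι (2 ^ j)) (ι (2 ^ j)) (ι (2 ^ (s ℕ.+ 2))) ⟩
    K * (ι (2 ^ j) * ι (2 ^ j) * ι (2 ^ (s ℕ.+ 2)))   ≡⟨ cong (K *_) (ι-*-* (2 ^ j) (2 ^ j) (2 ^ (s ℕ.+ 2))) ⟨
    K * ι (2 ^ j ℕ.* 2 ^ j ℕ.* 2 ^ (s ℕ.+ 2))         ≡⟨ cong (λ n → K * ι n) 2^-product ⟩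
    K * ι (2 ^ e)                                     ≡⟨ halfPow-*-2^ e ⟩
    1ℚ                                                ∎
    where
    open ≡-Reasoning
    e = suc j ℕ.+ (suc j ℕ.+ s)
    K = halfPow e
    2^-product : 2 ^ j ℕ.* 2 ^ j ℕ.* 2 ^ (s ℕ.+ 2) ≡ 2 ^ e
    2^-product = begin
      2 ^ j ℕ.* 2 ^ j ℕ.* 2 ^ (s ℕ.+ 2)  ≡⟨ cong (ℕ._* 2 ^ (s ℕ.+ 2)) (ℕP.^-distribˡ-+-* 2 j j) ⟨
      2 ^ (j ℕ.+ j) ℕ.* 2 ^ (s ℕ.+ 2)    ≡⟨ ℕP.^-distribˡ-+-* 2 (j ℕ.+ j) (s ℕ.+ 2) ⟨
      2 ^ (j ℕ.+ j ℕ.+ (s ℕ.+ 2))        ≡⟨ cong (2 ^_) (ℕsolve 2 (λ j s → j :+ℕ j :+ℕ (s :+ℕ conℕ 2)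
                                                                       :=ℕ conℕ 1 :+ℕ j :+ℕ (conℕ 1 :+ℕ j :+ℕ s))
                                                                  refl j s) ⟩
      2 ^ e                              ∎

  alt-scale : ∀ {l} → All (1 ≤_) l → ∀ S σ → alt S σ l ≡ σ * halfPow S * mink l
  alt-scale []                       S σ = sym (ℚP.*-zeroʳ (σ * halfPow S))
  alt-scale {suc a ∷ r} (_ ∷ r⁺) S σ = begin
    σ * halfPow (S ℕ.+ suc a ∸ 1) + alt (S ℕ.+ suc a) (- σ) r
      ≡⟨ cong₂ _+_ (cong (λ k → σ * halfPow (k ∸ 1)) (ℕP.+-suc S a)) (alt-scale r⁺ (S ℕ.+ suc a) (- σ)) ⟩
    σ * halfPow (S ℕ.+ a) + - σ * halfPow (S ℕ.+ suc a) * mink r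
      ≡⟨ cong₂ (λ u v → σ * u + - σ * v * mink r) (halfPow-+ S a) (halfPow-+ S (suc a)) ⟩
    σ * (halfPow S * halfPow a) + - σ * (halfPow S * halfPow (suc a)) * mink r
      ≡⟨ solve 5 (λ s hS ha hsa M → s :* (hS :* ha) :+ (:- s) :* (hS :* hsa) :* M
                                    := s :* hS :* (con 1ℚ :* ha :+ (:- con 1ℚ) :* hsa :* M))
               refl σ (halfPow S) (halfPow a) (halfPow (suc a)) (mink r) ⟩
    σ * halfPow S * (1ℚ * halfPow a + - 1ℚ * halfPow (suc a) * mink r)
      ≡⟨ cong (λ v → σ * halfPow S * (1ℚ * halfPow a + v)) (alt-scale r⁺ (suc a) (- 1ℚ)) ⟨
    σ * halfPow S * mink (suc a ∷ r)
      ∎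
    where open ≡-Reasoning

  alt-++ : ∀ l₁ l₂ S σ → alt S σ (l₁ ++ l₂) ≡ alt S σ l₁ + alt (S ℕ.+ sum l₁) (sign (length l₁) * σ) l₂
  alt-++ []       l₂ S σ = begin
    alt S σ l₂                      ≡⟨ cong₂ (λ u v → alt u v l₂) (ℕP.+-identityʳ S) (ℚP.*-identityˡ σ) ⟨
    alt (S ℕ.+ 0) (1ℚ * σ) l₂       ≡⟨ ℚP.+-identityˡ _ ⟨
    0ℚ + alt (S ℕ.+ 0) (1ℚ * σ) l₂  ∎
    where open ≡-Reasoning
  alt-++ (a ∷ l₁) l₂ S σ = begin
    head + alt (S ℕ.+ a) (- σ) (l₁ ++ l₂)
      ≡⟨ cong (head +_) (alt-++ l₁ l₂ (S ℕ.+ a) (- σ)) ⟩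
    head + (alt (S ℕ.+ a) (- σ) l₁ + alt (S ℕ.+ a ℕ.+ sum l₁) (sign (length l₁) * - σ) l₂)
      ≡⟨ ℚP.+-assoc head _ _ ⟨
    head + alt (S ℕ.+ a) (- σ) l₁ + alt (S ℕ.+ a ℕ.+ sum l₁) (sign (length l₁) * - σ) l₂
      ≡⟨ cong₂ (λ u v → head + alt (S ℕ.+ a) (- σ) l₁ + alt u v l₂) (ℕP.+-assoc S a (sum l₁))
               (solve 2 (λ g s → g :* (:- s) := (:- g) :* s) refl (sign (length l₁)) σ) ⟩
    head + alt (S ℕ.+ a) (- σ) l₁ + alt (S ℕ.+ (a ℕ.+ sum l₁)) (sign (suc (length l₁)) * σ) l₂
      ∎
    where
    open ≡-Reasoning
    head = σ * halfPow (S ℕ.+ a ∸ 1)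

  alt-∷ : ∀ {S} → 1 ≤ S → ∀ σ N {cs} → All (1 ≤_) cs →
          alt S σ (N ∷ cs) ≡ σ * (halfPow (S ℕ.+ N) * (ι 2 - mink cs))
  alt-∷ {suc B} _ σ N {cs} cs⁺ = begin
    σ * H + alt (suc B ℕ.+ N) (- σ) cs  ≡⟨ cong (σ * H +_) (alt-scale cs⁺ (suc B ℕ.+ N) (- σ)) ⟩
    σ * H + - σ * (½ * H) * mink cs     ≡⟨ solve 3 (λ s H μ → s :* H :+ (:- s) :* (con ½ :* H) :* μ
                                                           := s :* (con ½ :* H :* (con (ι 2) :- μ)))
                                                 refl σ H (mink cs) ⟩
    σ * (½ * H * (ι 2 - mink cs))       ∎
    where
    open ≡-Reasoning
    H = halfPow (B ℕ.+ N)

  mink-++-∷ : ∀ {as} → 1 ≤ sum as → ∀ N {cs} → All (1 ≤_) cs →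
              mink (as ++ N ∷ cs) ≡ mink as + sign (length as) * (halfPow (sum as ℕ.+ N) * (ι 2 - mink cs))
  mink-++-∷ {as} 1≤Σas N {cs} cs⁺ = begin
    mink (as ++ N ∷ cs)
      ≡⟨ alt-++ as (N ∷ cs) 0 1ℚ ⟩
    mink as + alt (sum as) (sign (length as) * 1ℚ) (N ∷ cs)
      ≡⟨ cong (λ σ → mink as + alt (sum as) σ (N ∷ cs)) (ℚP.*-identityʳ (sign (length as))) ⟩
    mink as + alt (sum as) (sign (length as)) (N ∷ cs)
      ≡⟨ cong (mink as +_) (alt-∷ 1≤Σas (sign (length as)) N cs⁺) ⟩
    mink as + sign (length as) * (halfPow (sum as ℕ.+ N) * (ι 2 - mink cs))
      ∎
    where open ≡-Reasoning

  record DyadicForm (l : List ℕ) : Set where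
    field
      j m      : ℕ
      sum≡1+j  : sum l ≡ suc j
      mink*2^j : mink l * ι (2 ^ j) ≡ ι m
      m-odd    : ¬ 2 ∣ m
      1≤m      : 1 ≤ m
      m≤2^j    : m ≤ 2 ^ j

  mink-dyadic : ∀ {l} → All (1 ≤_) l → 1 ≤ length l → DyadicForm l
  mink-dyadic {suc a ∷ []} (_ ∷ []) _ = record
    { j = a ; m = 1 ; sum≡1+j = cong suc (ℕP.+-identityʳ a)
    ; mink*2^j = trans (cong (_* ι (2 ^ a)) (solve 1 (λ h → con 1ℚ :* h :+ con 0ℚ := h) refl (halfPow a)))
                       (halfPow-*-2^ a)
    ; m-odd = λ 2∣1 → 2≢1 (∣1⇒≡1 2∣1) ; 1≤m = s≤s z≤n ; m≤2^j = ℕP.m^n>0 2 a }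
    where
    2≢1 : 2 ≢ 1
    2≢1 ()
  mink-dyadic {suc a ∷ r@(_ ∷ _)} (_ ∷ r⁺) _ = record
    { j = a ℕ.+ suc j ; m = X ∸ m ; sum≡1+j = cong (λ k → suc (a ℕ.+ k)) sum≡1+j
    ; mink*2^j = scaled ; m-odd = odd ; 1≤m = ℕP.m<n⇒0<n∸m m<X ; m≤2^j = bounded }
    where
    open DyadicForm (mink-dyadic r⁺ (s≤s z≤n))
    X = 2 ℕ.* 2 ^ j
    m<X : m < X
    m<X = ℕP.≤-<-trans m≤2^j (ℕP.m<m+n (2 ^ j) (subst (0 <_) (sym (ℕP.+-identityʳ (2 ^ j))) (ℕP.m^n>0 2 j)))
    bounded : X ∸ m ≤ 2 ^ (a ℕ.+ suc j)
    bounded = ℕP.≤-trans (ℕP.m∸n≤m X m)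
                (ℕP.≤-trans (ℕP.m≤n*m X (2 ^ a) {{ℕP.m^n≢0 2 a}})
                            (ℕP.≤-reflexive (sym (ℕP.^-distribˡ-+-* 2 a (suc j)))))
    odd : ¬ 2 ∣ X ∸ m
    odd 2∣X∸m = m-odd (∣m+n∣m⇒∣n (subst (2 ∣_) (sym (ℕP.m∸n+n≡m (ℕP.<⇒≤ m<X)))
                                                (divides (2 ^ j) (ℕP.*-comm 2 (2 ^ j)))) 2∣X∸m)
    M = mink r
    scaled : mink (suc a ∷ r) * ι (2 ^ (a ℕ.+ suc j)) ≡ ι (X ∸ m)
    scaled = begin
      (1ℚ * halfPow a + alt (suc a) (- 1ℚ) r) * ι (2 ^ (a ℕ.+ suc j))
        ≡⟨ cong₂ (λ u v → (1ℚ * halfPow a + u) * ι v) (alt-scale r⁺ (suc a) (- 1ℚ)) (ℕP.^-distribˡ-+-* 2 a (suc j)) ⟩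
      (1ℚ * halfPow a + - 1ℚ * (½ * halfPow a) * M) * ι (2 ^ a ℕ.* (2 ℕ.* 2 ^ j))
        ≡⟨ cong (λ u → (1ℚ * halfPow a + - 1ℚ * (½ * halfPow a) * M) * u)
                (trans (ι-* (2 ^ a) (2 ℕ.* 2 ^ j)) (cong (ι (2 ^ a) *_) (ι-* 2 (2 ^ j)))) ⟩
      (1ℚ * halfPow a + - 1ℚ * (½ * halfPow a) * M) * (ι (2 ^ a) * (ι 2 * ι (2 ^ j)))
        ≡⟨ solve 4 (λ h M P J → (con 1ℚ :* h :+ (:- con 1ℚ) :* (con ½ :* h) :* M) :* (P :* (con (ι 2) :* J))
                                := (h :* P) :* (con (ι 2) :* J :- M :* J))
                 refl (halfPow a) M (ι (2 ^ a)) (ι (2 ^ j)) ⟩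
      halfPow a * ι (2 ^ a) * (ι 2 * ι (2 ^ j) - M * ι (2 ^ j))
        ≡⟨ cong₂ (λ u v → u * (ι 2 * ι (2 ^ j) - v)) (halfPow-*-2^ a) mink*2^j ⟩
      1ℚ * (ι 2 * ι (2 ^ j) - ι m)
        ≡⟨ ℚP.*-identityˡ _ ⟩
      ι 2 * ι (2 ^ j) - ι m
        ≡⟨ cong (_- ι m) (ι-* 2 (2 ^ j)) ⟨
      ι X - ι m
        ≡⟨ ι-∸ (ℕP.<⇒≤ m<X) ⟨
      ι (X ∸ m)
        ∎
      where open ≡-Reasoning

  -- Denominators of dyadic convergents

  odd⇒coprime-2 : ∀ {t} → ¬ 2 ∣ t → Coprime t 2
  odd⇒coprime-2 _     {zero}              (_ , 0∣2) with () ← 0∣⇒≡0 0∣2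
  odd⇒coprime-2 _     {suc zero}          _         = refl
  odd⇒coprime-2 t-odd {suc (suc zero)}    (2∣t , _) = ⊥-elim (t-odd 2∣t)
  odd⇒coprime-2 _     {suc (suc (suc _))} (_ , d∣2) with s≤s (s≤s ()) ← ∣⇒≤ d∣2

  odd∣2^⇒≡1 : ∀ j {t} → t ∣ 2 ^ j → ¬ 2 ∣ t → t ≡ 1
  odd∣2^⇒≡1 zero    t∣1     _     = ∣1⇒≡1 t∣1
  odd∣2^⇒≡1 (suc j) t∣2^1+j t-odd = odd∣2^⇒≡1 j (Coprime.coprime-divisor (odd⇒coprime-2 t-odd) t∣2^1+j) t-odd

  *-∸-≡ : ∀ d x y D → d ℕ.* x ≡ d ℕ.* y ℕ.+ D → d ℕ.* (x ∸ y) ≡ D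
  *-∸-≡ d x y D eq = begin
    d ℕ.* (x ∸ y)              ≡⟨ ℕP.*-distribˡ-∸ d x y ⟩
    d ℕ.* x ∸ d ℕ.* y          ≡⟨ cong (_∸ d ℕ.* y) eq ⟩
    d ℕ.* y ℕ.+ D ∸ d ℕ.* y    ≡⟨ ℕP.m+n∸m≡n (d ℕ.* y) D ⟩
    D                          ∎
    where open ≡-Reasoning

  unimodular-cofactor : ∀ {α β γ δ m D} → Unimodular α β γ δ → β ℕ.* D ≡ m ℕ.* δ → ∃[ t ] δ ℕ.* t ≡ D
  unimodular-cofactor {α} {β} {γ} {δ} {m} {D} (inj₁ αδ≡βγ+1) βD≡mδ = α ℕ.* D ∸ m ℕ.* γ , *-∸-≡ δ _ _ D (begin
    δ ℕ.* (α ℕ.* D)          ≡⟨ ℕsolve 3 (λ d a D → d :*ℕ (a :*ℕ D) :=ℕ (a :*ℕ d) :*ℕ D) refl δ α D ⟩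
    α ℕ.* δ ℕ.* D            ≡⟨ cong (ℕ._* D) αδ≡βγ+1 ⟩
    (β ℕ.* γ ℕ.+ 1) ℕ.* D    ≡⟨ ℕsolve 3 (λ b g D → (b :*ℕ g :+ℕ conℕ 1) :*ℕ D :=ℕ (b :*ℕ D) :*ℕ g :+ℕ D)
                                        refl β γ D ⟩
    β ℕ.* D ℕ.* γ ℕ.+ D      ≡⟨ cong (λ u → u ℕ.* γ ℕ.+ D) βD≡mδ ⟩
    m ℕ.* δ ℕ.* γ ℕ.+ D      ≡⟨ cong (ℕ._+ D) (ℕsolve 3 (λ m d g → (m :*ℕ d) :*ℕ g :=ℕ d :*ℕ (m :*ℕ g))
                                                      refl m δ γ) ⟩
    δ ℕ.* (m ℕ.* γ) ℕ.+ D    ∎)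
    where open ≡-Reasoning
  unimodular-cofactor {α} {β} {γ} {δ} {m} {D} (inj₂ βγ≡αδ+1) βD≡mδ = m ℕ.* γ ∸ α ℕ.* D , *-∸-≡ δ _ _ D (begin
    δ ℕ.* (m ℕ.* γ)          ≡⟨ ℕsolve 3 (λ d m g → d :*ℕ (m :*ℕ g) :=ℕ (m :*ℕ d) :*ℕ g) refl δ m γ ⟩
    m ℕ.* δ ℕ.* γ            ≡⟨ cong (ℕ._* γ) βD≡mδ ⟨
    β ℕ.* D ℕ.* γ            ≡⟨ ℕsolve 3 (λ b D g → (b :*ℕ D) :*ℕ g :=ℕ (b :*ℕ g) :*ℕ D) refl β D γ ⟩
    β ℕ.* γ ℕ.* D            ≡⟨ cong (ℕ._* D) βγ≡αδ+1 ⟩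
    (α ℕ.* δ ℕ.+ 1) ℕ.* D    ≡⟨ ℕsolve 3 (λ a d D → (a :*ℕ d :+ℕ conℕ 1) :*ℕ D :=ℕ d :*ℕ (a :*ℕ D) :+ℕ D)
                                        refl α δ D ⟩
    δ ℕ.* (α ℕ.* D) ℕ.+ D    ∎)
    where open ≡-Reasoning

  unimodular-denominator : ∀ {α β γ δ m} j → Unimodular α β γ δ → β ℕ.* 2 ^ j ≡ m ℕ.* δ → ¬ 2 ∣ m →
                           δ ≡ 2 ^ j
  unimodular-denominator {α} {β} {γ} {δ} {m} j unimodular βD≡mδ m-odd = begin
    δ            ≡⟨ ℕP.*-identityʳ δ ⟨
    δ ℕ.* 1      ≡⟨ cong (δ ℕ.*_) t≡1 ⟨
    δ ℕ.* t      ≡⟨ δt≡D ⟩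
    2 ^ j        ∎
    where
    open ≡-Reasoning
    cofactor = unimodular-cofactor {α} {β} {γ} {δ} {m} unimodular βD≡mδ
    t = proj₁ cofactor
    δt≡D = proj₂ cofactor
    instance
      δ≢0 : ℕ.NonZero δ
      δ≢0 = ℕ.≢-nonZero λ { refl → ℕP.<⇒≢ (ℕP.m^n>0 2 j) δt≡D }
    βt≡m : β ℕ.* t ≡ m
    βt≡m = ℕP.*-cancelˡ-≡ (β ℕ.* t) m δ (begin
      δ ℕ.* (β ℕ.* t)  ≡⟨ ℕsolve 3 (λ d b t → d :*ℕ (b :*ℕ t) :=ℕ b :*ℕ (d :*ℕ t)) refl δ β t ⟩
      β ℕ.* (δ ℕ.* t)  ≡⟨ cong (β ℕ.*_) δt≡D ⟩
      β ℕ.* 2 ^ j      ≡⟨ βD≡mδ ⟩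
      m ℕ.* δ          ≡⟨ ℕP.*-comm m δ ⟩
      δ ℕ.* m          ∎)
    t≡1 : t ≡ 1
    t≡1 = odd∣2^⇒≡1 j (divides δ (sym δt≡D)) (λ 2∣t → m-odd (∣-trans 2∣t (divides β (sym βt≡m))))

  cfMatrix-δ≡2^ : ∀ {L} → All (1 ≤_) L → ∀ j {m} → cf L * ι (2 ^ j) ≡ ι m → ¬ 2 ∣ m →
                  Matrix.δ (cfMatrix L) ≡ 2 ^ j
  cfMatrix-δ≡2^ {L} L⁺ j {m} cf*2^j≡m m-odd =
    unimodular-denominator {α} {β} {γ} {δ} j (cfMatrix-unimodular L) (ι-injective (begin
      ι (β ℕ.* 2 ^ j)         ≡⟨ ι-* β (2 ^ j) ⟩
      ι β * ι (2 ^ j)         ≡⟨ cong (_* ι (2 ^ j)) (cf*δ≡β L⁺) ⟨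
      cf L * ι δ * ι (2 ^ j)  ≡⟨ solve 3 (λ x d t → x :* d :* t := x :* t :* d) refl (cf L) (ι δ) (ι (2 ^ j)) ⟩
      cf L * ι (2 ^ j) * ι δ  ≡⟨ cong (_* ι δ) cf*2^j≡m ⟩
      ι m * ι δ               ≡⟨ ι-* m δ ⟨
      ι (m ℕ.* δ)             ∎)) m-odd
    where
    open ≡-Reasoning
    open Matrix (cfMatrix L)

  -- Expansion of a fraction

  record Expansion (N D : ℕ) : Set where
    field
      z        : ℕ
      rest     : List ℕ
      1≤z      : 1 ≤ z
      rest⁺    : All (1 ≤_) rest
      value    : ι N ≡ (ι z + cf rest) * ι D
      z*D<N    : z ℕ.* D < N
      N≤1+z*D  : N ≤ suc z ℕ.* D

  cf-expansion : ∀ {D} → Acc _<_ D → ∀ {N} → 1 ≤ D → D < N → Expansion N D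
  cf-expansion {D} (acc smaller) {N} 1≤D D<N = by-division (N % D) (N / D) (m≡m%n+[m/n]*n N D) (m%n<n N D)
    where
    instance
      D≢0 : ℕ.NonZero D
      D≢0 = ℕ.>-nonZero 1≤D
    by-division : ∀ r q → N ≡ r ℕ.+ q ℕ.* D → r < D → Expansion N D
    by-division zero zero N≡0 _ = ⊥-elim (ℕP.<-irrefl (sym N≡0) (ℕP.<-trans 1≤D D<N))
    by-division zero (suc zero) N≡D _ = ⊥-elim (ℕP.<-irrefl (trans (sym (ℕP.+-identityʳ D)) (sym N≡D)) D<N)
    by-division zero (suc (suc q)) N≡[2+q]D _ = record
      { z = suc q ; rest = [ 1 ] ; 1≤z = s≤s z≤n ; rest⁺ = s≤s z≤n ∷ []
      ; value = begin
          ι N                           ≡⟨ cong ι N≡[2+q]D ⟩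
          ι (suc (suc q) ℕ.* D)         ≡⟨ ι-* (suc (suc q)) D ⟩
          ι (suc (suc q)) * ι D         ≡⟨ cong (_* ι D) (ι-suc (suc q)) ⟩
          (ι (suc q) + cf [ 1 ]) * ι D  ∎
      ; z*D<N = subst (suc q ℕ.* D <_) (sym N≡[2+q]D) (ℕP.m<n+m (suc q ℕ.* D) 1≤D)
      ; N≤1+z*D = ℕP.≤-reflexive N≡[2+q]D }
      where open ≡-Reasoning
    by-division (suc r) zero N≡1+r 1+r<D =
      ⊥-elim (ℕP.<-asym D<N (subst (_< D) (sym (trans N≡1+r (ℕP.+-identityʳ (suc r)))) 1+r<D))
    by-division (suc r) (suc q) N≡1+r+[1+q]D 1+r<D = record
      { z = suc q ; rest = b ∷ rest′ ; 1≤z = s≤s z≤n ; rest⁺ = 1≤b ∷ rest′⁺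
      ; value = begin
          ι N                                        ≡⟨ cong ι N≡1+r+[1+q]D ⟩
          ι (suc r ℕ.+ suc q ℕ.* D)                  ≡⟨ ι-+-* (suc r) (suc q) D ⟩
          ι (suc r) + ι (suc q) * ι D                ≡⟨ cong (_+ ι (suc q) * ι D) (inv-cancelˡ (ι (suc r)) Y≢0) ⟨
          inv Y * (Y * ι (suc r)) + ι (suc q) * ι D  ≡⟨ cong (λ u → inv Y * u + ι (suc q) * ι D) value′ ⟨
          inv Y * ι D + ι (suc q) * ι D              ≡⟨ ℚP.*-distribʳ-+ (ι D) (inv Y) (ι (suc q)) ⟨
          (inv Y + ι (suc q)) * ι D                  ≡⟨ cong (_* ι D) (ℚP.+-comm (inv Y) (ι (suc q))) ⟩
          (ι (suc q) + inv Y) * ι D                  ∎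
      ; z*D<N = subst (suc q ℕ.* D <_) (sym N≡1+r+[1+q]D) (ℕP.m<n+m (suc q ℕ.* D) {suc r} (s≤s z≤n))
      ; N≤1+z*D = subst (_≤ D ℕ.+ suc q ℕ.* D) (sym N≡1+r+[1+q]D)
                        (ℕP.+-monoˡ-≤ (suc q ℕ.* D) (ℕP.<⇒≤ 1+r<D)) }
      where
      open ≡-Reasoning
      open Expansion (cf-expansion (smaller 1+r<D) (s≤s z≤n) 1+r<D)
        renaming (z to b; rest to rest′; 1≤z to 1≤b; rest⁺ to rest′⁺; value to value′)
      Y = ι b + cf rest′
      Y≢0 : Y ≢ 0ℚ
      Y≢0 = pos⇒≢0 (quotient-pos 1≤b rest′)

  record BoundedExpansion (N D P Q : ℕ) : Set where
    field
      expansion : Expansion N D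
    open Expansion expansion public
    field
      P∸1≤z : P ∸ 1 ≤ z
      z≤Q∸1 : z ≤ Q ∸ 1

  bounded-expansion : ∀ {P Q D N} → 1 ≤ D → 2 ≤ P → P ℕ.* D < N ℕ.+ D → N ≤ Q ℕ.* D → BoundedExpansion N D P Q
  bounded-expansion {P} {Q} {D} {N} 1≤D 2≤P PD<N+D N≤QD = record
    { expansion = e ; P∸1≤z = ℕP.∸-monoˡ-≤ 1 (ℕP.≤-pred P<2+z) ; z≤Q∸1 = ℕP.∸-monoˡ-≤ 1 z<Q }
    where
    D<N : D < N
    D<N = ℕP.+-cancelʳ-< D D N
            (ℕP.≤-<-trans (subst (_≤ P ℕ.* D) (cong (D ℕ.+_) (ℕP.+-identityʳ D)) (ℕP.*-monoˡ-≤ D 2≤P)) PD<N+D)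
    e = cf-expansion (<-wellFounded D) 1≤D D<N
    open Expansion e
    z<Q : z < Q
    z<Q = ℕP.*-cancelʳ-< D z Q (ℕP.<-≤-trans z*D<N N≤QD)
    P<2+z : P < suc (suc z)
    P<2+z = ℕP.*-cancelʳ-< D P (suc (suc z))
              (ℕP.<-≤-trans PD<N+D (subst (N ℕ.+ D ≤_) (ℕP.+-comm (suc z ℕ.* D) D) (ℕP.+-monoˡ-≤ D N≤1+z*D)))

  -- The partial quotient following ?([a₁,…,a_{n−1}])

  2*n∸m-bounds : ∀ {n m} → 1 ≤ m → m ≤ n → n ≤ 2 ℕ.* n ∸ m × 2 ℕ.* n ∸ m < 2 ℕ.* n
  2*n∸m-bounds {n} {m} 1≤m m≤n =
    subst (_≤ 2 ℕ.* n ∸ m) (trans (ℕP.m+n∸m≡n n (n ℕ.+ 0)) (ℕP.+-identityʳ n)) (ℕP.∸-monoʳ-≤ (2 ℕ.* n) m≤n) ,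
    ℕP.∸-monoʳ-< 1≤m (ℕP.≤-trans m≤n (ℕP.m≤m+n n (n ℕ.+ 0)))

  numerator-bounds : ∀ {P Dc E d g N} → 1 ≤ P → 1 ≤ d → Dc ≤ E → E < 2 ℕ.* Dc → g ≤ d →
                     N ℕ.+ g ℕ.* E ≡ 2 ℕ.* P ℕ.* Dc ℕ.* d →
                     P ℕ.* (E ℕ.* d) < N ℕ.+ E ℕ.* d × N ≤ 2 ℕ.* P ℕ.* (E ℕ.* d)
  numerator-bounds {P} {Dc} {E} {d} {g} {N} 1≤P 1≤d Dc≤E E<2Dc g≤d N+gE≡2PDcd = lower , upper
    where
    open ℕP.≤-Reasoning
    instance
      P≢0 : ℕ.NonZero P
      P≢0 = ℕ.>-nonZero 1≤P
      d≢0 : ℕ.NonZero d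
      d≢0 = ℕ.>-nonZero 1≤d
    lower : P ℕ.* (E ℕ.* d) < N ℕ.+ E ℕ.* d
    lower = begin-strict
      P ℕ.* (E ℕ.* d)         <⟨ ℕP.*-monoʳ-< P (ℕP.*-monoˡ-< d E<2Dc) ⟩
      P ℕ.* (2 ℕ.* Dc ℕ.* d)  ≡⟨ ℕsolve 3 (λ P D d → P :*ℕ (conℕ 2 :*ℕ D :*ℕ d) :=ℕ conℕ 2 :*ℕ P :*ℕ D :*ℕ d)
                                       refl P Dc d ⟩
      2 ℕ.* P ℕ.* Dc ℕ.* d    ≡⟨ N+gE≡2PDcd ⟨
      N ℕ.+ g ℕ.* E           ≤⟨ ℕP.+-monoʳ-≤ N (subst (g ℕ.* E ≤_) (ℕP.*-comm d E) (ℕP.*-monoˡ-≤ E g≤d)) ⟩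
      N ℕ.+ E ℕ.* d           ∎
    upper : N ≤ 2 ℕ.* P ℕ.* (E ℕ.* d)
    upper = begin
      N                       ≤⟨ ℕP.m≤m+n N (g ℕ.* E) ⟩
      N ℕ.+ g ℕ.* E           ≡⟨ N+gE≡2PDcd ⟩
      2 ℕ.* P ℕ.* Dc ℕ.* d    ≡⟨ ℕP.*-assoc (2 ℕ.* P) Dc d ⟩
      2 ℕ.* P ℕ.* (Dc ℕ.* d)  ≤⟨ ℕP.*-monoʳ-≤ (2 ℕ.* P) (ℕP.*-monoˡ-≤ d Dc≤E) ⟩
      2 ℕ.* P ℕ.* (E ℕ.* d)   ∎

  2^[s+2]≡2*2^[s+1] : ∀ s → 2 ^ (s ℕ.+ 2) ≡ 2 ℕ.* 2 ^ (s ℕ.+ 1)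
  2^[s+2]≡2*2^[s+1] s = cong (2 ^_) (ℕP.+-suc s 1)

  2≤2^[s+1] : ∀ s → 2 ≤ 2 ^ (s ℕ.+ 1)
  2≤2^[s+1] s = subst (λ k → 2 ≤ 2 ^ k) (ℕP.+-comm 1 s) (ℕP.*-monoʳ-≤ 2 (ℕP.m^n>0 2 s))

  numerator-untruncated : ∀ s {d g} Dc mc → g ≤ d → g ℕ.* (2 ℕ.* Dc ∸ mc) ≤ 2 ^ (s ℕ.+ 2) ℕ.* Dc ℕ.* d
  numerator-untruncated s {d} {g} Dc mc g≤d = begin
    g ℕ.* E                  ≤⟨ ℕP.*-monoˡ-≤ E g≤d ⟩
    d ℕ.* E                  ≤⟨ ℕP.*-monoʳ-≤ d (ℕP.≤-trans (ℕP.m∸n≤m (2 ℕ.* Dc) mc)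
                                                           (ℕP.*-monoˡ-≤ Dc 2≤Q)) ⟩
    d ℕ.* (Q ℕ.* Dc)         ≡⟨ ℕP.*-comm d (Q ℕ.* Dc) ⟩
    Q ℕ.* Dc ℕ.* d           ∎
    where
    open ℕP.≤-Reasoning
    E = 2 ℕ.* Dc ∸ mc
    Q = 2 ^ (s ℕ.+ 2)
    2≤Q : 2 ≤ Q
    2≤Q = subst (2 ≤_) (sym (2^[s+2]≡2*2^[s+1] s)) (ℕP.*-monoʳ-≤ 2 (ℕP.m^n>0 2 (s ℕ.+ 1)))

  quotient-expansion : ∀ s {d g Dc mc} → 1 ≤ d → g ≤ d → 1 ≤ mc → mc ≤ Dc →
    let E = 2 ℕ.* Dc ∸ mc in
    BoundedExpansion (2 ^ (s ℕ.+ 2) ℕ.* Dc ℕ.* d ∸ g ℕ.* E) (E ℕ.* d) (2 ^ (s ℕ.+ 1)) (2 ^ (s ℕ.+ 2))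
  quotient-expansion s {d} {g} {Dc} {mc} 1≤d g≤d 1≤mc mc≤Dc =
    bounded-expansion (ℕP.*-mono-≤ (ℕP.≤-trans (ℕP.≤-trans 1≤mc mc≤Dc) Dc≤E) 1≤d) (2≤2^[s+1] s)
                      (proj₁ bounds) (subst (λ q → N ≤ q ℕ.* (E ℕ.* d)) (sym Q≡2P) (proj₂ bounds))
    where
    E = 2 ℕ.* Dc ∸ mc
    N = 2 ^ (s ℕ.+ 2) ℕ.* Dc ℕ.* d ∸ g ℕ.* E
    Q≡2P = 2^[s+2]≡2*2^[s+1] s
    Dc≤E = proj₁ (2*n∸m-bounds 1≤mc mc≤Dc)
    bounds = numerator-bounds (ℕP.m^n>0 2 (s ℕ.+ 1)) 1≤d Dc≤E (proj₂ (2*n∸m-bounds 1≤mc mc≤Dc)) g≤d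
               (trans (ℕP.m∸n+n≡m (numerator-untruncated s Dc mc g≤d)) (cong (λ q → q ℕ.* Dc ℕ.* d) Q≡2P))

  möbius-solution : ∀ {α β γ δ x σ h W T} → δ ≢ 0ℚ → x * δ ≡ β → α * δ - β * γ ≡ σ → T ≡ x + σ * h →
                    h * δ * (γ + δ * W) ≡ 1ℚ → T * (γ + δ * W) ≡ α + β * W
  möbius-solution {α} {β} {γ} {δ} {x} {σ} {h} {W} {T} δ≢0 xδ≡β det≡σ T≡x+σh hδY≡1 = *-cancelʳ-≢0 δ≢0 (begin
    T * Y * δ                     ≡⟨ cong (λ t → t * Y * δ) T≡x+σh ⟩
    (x + σ * h) * Y * δ           ≡⟨ solve 5 (λ x σ h Y δ → (x :+ σ :* h) :* Y :* δ := x :* δ :* Y :+ σ :* (h :* δ :* Y))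
                                           refl x σ h Y δ ⟩
    x * δ * Y + σ * (h * δ * Y)   ≡⟨ cong₂ (λ u v → u * Y + σ * v) xδ≡β hδY≡1 ⟩
    β * Y + σ * 1ℚ                ≡⟨ cong (λ u → β * Y + u * 1ℚ) det≡σ ⟨
    β * Y + (α * δ - β * γ) * 1ℚ  ≡⟨ solve 5 (λ α β γ δ W → β :* (γ :+ δ :* W) :+ (α :* δ :- β :* γ) :* con 1ℚ
                                                        := (α :+ β :* W) :* δ)
                                           refl α β γ δ W ⟩
    (α + β * W) * δ               ∎)
    where
    open ≡-Reasoning
    Y = γ + δ * W

  denominator-identity : ∀ {K μ δ γ W Dc m E N Q} → Dc ≢ 0ℚ → K * δ * δ * Q ≡ 1ℚ → μ * Dc ≡ m →
                         E ≡ ι 2 * Dc - m → N + γ * E ≡ Q * Dc * δ → N ≡ W * (E * δ) →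
                         K * (ι 2 - μ) * δ * (γ + δ * W) ≡ 1ℚ
  denominator-identity {K} {μ} {δ} {γ} {W} {Dc} {m} {E} {N} {Q} Dc≢0 Kδ²Q≡1 μDc≡m E≡2Dc-m N+γE≡QDcδ N≡WEδ =
    *-cancelʳ-≢0 Dc≢0 (begin
      K * (ι 2 - μ) * δ * (γ + δ * W) * Dc
        ≡⟨ solve 6 (λ K μ δ γ W Dc → K :* (con (ι 2) :- μ) :* δ :* (γ :+ δ :* W) :* Dc
                                     := K :* δ :* (γ :* (con (ι 2) :* Dc :- μ :* Dc) :+ W :* ((con (ι 2) :* Dc :- μ :* Dc) :* δ)))
                 refl K μ δ γ W Dc ⟩
      K * δ * (γ * (ι 2 * Dc - μ * Dc) + W * ((ι 2 * Dc - μ * Dc) * δ))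
        ≡⟨ cong (λ e → K * δ * (γ * e + W * (e * δ))) (trans (cong (λ u → ι 2 * Dc - u) μDc≡m) (sym E≡2Dc-m)) ⟩
      K * δ * (γ * E + W * (E * δ))
        ≡⟨ cong (λ n → K * δ * (γ * E + n)) N≡WEδ ⟨
      K * δ * (γ * E + N)
        ≡⟨ cong (K * δ *_) (trans (ℚP.+-comm (γ * E) N) N+γE≡QDcδ) ⟩
      K * δ * (Q * Dc * δ)
        ≡⟨ solve 4 (λ K δ Q Dc → K :* δ :* (Q :* Dc :* δ) := K :* δ :* δ :* Q :* Dc) refl K δ Q Dc ⟩
      K * δ * δ * Q * Dc
        ≡⟨ cong (_* Dc) Kδ²Q≡1 ⟩
      1ℚ * Dc
        ∎)
    where open ≡-Reasoning

  Extends : List ℕ → ℕ → ℚ → Set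
  Extends L s T = ∃[ z ] ∃[ rest ] (2 ^ (s ℕ.+ 1) ∸ 1 ≤ z × z ≤ 2 ^ (s ℕ.+ 2) ∸ 1 × All (1 ≤_) rest
                                    × T ≡ cf (L ++ z ∷ rest))

  mink-extension : ∀ {L as cs} → All (1 ≤_) L → All (1 ≤_) as → 1 ≤ length as → All (1 ≤_) cs → 1 ≤ length cs →
                   mink as ≡ cf L → sign (length as) ≡ sign (length L) → ∀ s →
                   Extends L s (mink (as ++ (sum as ℕ.+ s) ∷ cs))
  mink-extension {L} {as} {cs} L⁺ as⁺ 1≤|as| cs⁺ 1≤|cs| x≡cfL signs s =
    z , rest , P∸1≤z , z≤Q∸1 , rest⁺ , *-cancelʳ-≢0 Y≢0 (trans T*Y≡α+βW (sym (cf-++-∷ L⁺ 1≤z rest)))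
    where
    open Matrix (cfMatrix L)
    module A = DyadicForm (mink-dyadic as⁺ 1≤|as|)
    module C = DyadicForm (mink-dyadic cs⁺ 1≤|cs|)
    T  = mink (as ++ (sum as ℕ.+ s) ∷ cs)
    K  = halfPow (sum as ℕ.+ (sum as ℕ.+ s))
    Dc = 2 ^ C.j
    E  = 2 ℕ.* Dc ∸ C.m
    Q  = 2 ^ (s ℕ.+ 2)
    -- N/(E δ) = 2^{s+2}/(2 − μ) − γ/δ, since μ = C.m/Dc.
    N  = Q ℕ.* Dc ℕ.* δ ∸ γ ℕ.* E
    open BoundedExpansion (quotient-expansion s (1≤δ L⁺) (γ≤δ L⁺) C.1≤m C.m≤2^j)
    W  = ι z + cf rest
    Y  = ι γ + ι δ * W
    Y≢0 : Y ≢ 0ℚ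
    Y≢0 = pos⇒≢0 (ℚP.+-mono-≤-< (ι-nonNeg γ) (pos*pos⇒pos (ι-mono-< (1≤δ L⁺)) (quotient-pos 1≤z rest)))
    δ≡2^j : δ ≡ 2 ^ A.j
    δ≡2^j = cfMatrix-δ≡2^ L⁺ A.j (subst (λ x → x * ι (2 ^ A.j) ≡ ι A.m) x≡cfL A.mink*2^j) A.m-odd
    Kδ²Q≡1 : K * ι δ * ι δ * ι Q ≡ 1ℚ
    Kδ²Q≡1 = subst₂ (λ S d → halfPow (S ℕ.+ (S ℕ.+ s)) * ι d * ι d * ι Q ≡ 1ℚ) (sym A.sum≡1+j) (sym δ≡2^j)
                    (halfPow-*-2^-square A.j s)
    E≡2Dc-m : ι E ≡ ι 2 * ι Dc - ι C.m
    E≡2Dc-m = trans (ι-∸ (ℕP.≤-trans C.m≤2^j (ℕP.m≤m+n Dc (Dc ℕ.+ 0)))) (cong (_- ι C.m) (ι-* 2 Dc))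
    N+γE≡QDcδ : ι N + ι γ * ι E ≡ ι Q * ι Dc * ι δ
    N+γE≡QDcδ = trans (sym (ι-+-* N γ E))
                  (trans (cong ι (ℕP.m∸n+n≡m (numerator-untruncated s Dc C.m (γ≤δ L⁺)))) (ι-*-* Q Dc δ))
    N≡W*Eδ : ι N ≡ W * (ι E * ι δ)
    N≡W*Eδ = trans value (cong (W *_) (ι-* E δ))
    δ≢0 : ι δ ≢ 0ℚ
    δ≢0 = pos⇒≢0 (ι-mono-< (1≤δ L⁺))
    x*δ≡β : mink as * ι δ ≡ ι β
    x*δ≡β = trans (cong (_* ι δ) x≡cfL) (cf*δ≡β L⁺)
    det≡σ : ι α * ι δ - ι β * ι γ ≡ sign (length as)
    det≡σ = trans (cfMatrix-det L) (sym signs)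
    T≡x+σh : T ≡ mink as + sign (length as) * (K * (ι 2 - mink cs))
    T≡x+σh = mink-++-∷ {as} (subst (1 ≤_) (sym A.sum≡1+j) (s≤s z≤n)) (sum as ℕ.+ s) cs⁺
    hδY≡1 : K * (ι 2 - mink cs) * ι δ * Y ≡ 1ℚ
    hδY≡1 = denominator-identity {K} {mink cs} {ι δ} {ι γ} {W} (pos⇒≢0 (ι-mono-< (ℕP.m^n>0 2 C.j)))
              Kδ²Q≡1 C.mink*2^j E≡2Dc-m N+γE≡QDcδ N≡W*Eδ
    T*Y≡α+βW : T * Y ≡ ι α + ι β * W
    T*Y≡α+βW = möbius-solution {ι α} {ι β} {ι γ} {ι δ} {mink as} {sign (length as)} {K * (ι 2 - mink cs)} {W}
                 δ≢0 x*δ≡β det≡σ T≡x+σh hδY≡1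

  sign-+1 : ∀ a → sign (a ℕ.+ 1) ≡ - sign a
  sign-+1 a = cong sign (ℕP.+-comm a 1)

  sign-+2 : ∀ a → sign (a ℕ.+ 2) ≡ sign a
  sign-+2 a = trans (cong sign (ℕP.+-comm a 2)) (solve 1 (λ x → :- (:- x) := x) refl (sign a))

  sign-%2 : ∀ a → sign a ≡ sign (a % 2)
  sign-%2 zero          = refl
  sign-%2 (suc zero)    = refl
  sign-%2 (suc (suc a)) = begin
    sign (suc (suc a))      ≡⟨ solve 1 (λ x → :- (:- x) := x) refl (sign a) ⟩
    sign a                  ≡⟨ sign-%2 a ⟩
    sign (a % 2)            ≡⟨ cong sign ([m+n]%n≡m%n a 2) ⟨
    sign ((a ℕ.+ 2) % 2)    ≡⟨ cong (λ k → sign (k % 2)) (ℕP.+-comm a 2) ⟩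
    sign (suc (suc a) % 2)  ∎
    where open ≡-Reasoning

  sign-cong-%2 : ∀ a b → a % 2 ≡ b % 2 → sign a ≡ sign b
  sign-cong-%2 a b a≡b = trans (sign-%2 a) (trans (cong sign a≡b) (sym (sign-%2 b)))

  1≢-1 : 1ℚ ≢ - 1ℚ
  1≢-1 ()

  sign≢-sign : ∀ a → sign a ≢ - sign a
  sign≢-sign a eq with sign-cases a
  ... | inj₁ ≡1  = 1≢-1 (trans (sym ≡1) (trans eq (cong -_ ≡1)))
  ... | inj₂ ≡-1 = 1≢-1 (trans (sym (cong -_ ≡-1)) (trans (sym eq) ≡-1))

  sign≡⇒sign-+1≢ : ∀ {a b} → sign a ≡ sign b → sign (a ℕ.+ 1) ≢ sign b
  sign≡⇒sign-+1≢ {a} {b} a≡b a+1≡b = sign≢-sign b (trans (sym a+1≡b) (trans (sign-+1 a) (cong -_ a≡b)))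

  sign-cases₂ : ∀ a b → sign a ≡ sign b ⊎ sign a ≡ sign (b ℕ.+ 1)
  sign-cases₂ a b with sign-cases a | sign-cases b
  ... | inj₁ a≡1  | inj₁ b≡1  = inj₁ (trans a≡1 (sym b≡1))
  ... | inj₁ a≡1  | inj₂ b≡-1 = inj₂ (trans a≡1 (sym (trans (sign-+1 b) (cong -_ b≡-1))))
  ... | inj₂ a≡-1 | inj₁ b≡1  = inj₂ (trans a≡-1 (sym (trans (sign-+1 b) (cong -_ b≡1))))
  ... | inj₂ a≡-1 | inj₂ b≡-1 = inj₁ (trans a≡-1 (sym b≡-1))

  cf-++-split-last : ∀ l {a} → 1 ≤ a → cf (l ++ (a ∸ 1) ∷ [ 1 ]) ≡ cf (l ++ [ a ])
  cf-++-split-last []      {suc a} _ = cong inv (trans (sym (ι-suc a)) (sym (ℚP.+-identityʳ (ι (suc a)))))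
  cf-++-split-last (b ∷ l) 1≤a       = cong (λ c → inv (ι b + c)) (cf-++-split-last l 1≤a)

  split-last⁺ : ∀ {l a} → All (1 ≤_) l → 1 ≤ a → a ≢ 1 → All (1 ≤_) (l ++ (a ∸ 1) ∷ [ 1 ])
  split-last⁺ {a = suc zero}    _  _ a≢1 = ⊥-elim (a≢1 refl)
  split-last⁺ {a = suc (suc _)} l⁺ _ _   = ++⁺ l⁺ (s≤s z≤n ∷ s≤s z≤n ∷ [])

open ContinuedFractions

open import Data.Empty using (⊥-elim)
open import Data.List using (List; []; _∷_; _++_; length; [_])
open import Data.List.Properties using (++-assoc; length-++)
open import Data.List.Relation.Unary.All using (All; []; _∷_)
open import Data.List.Relation.Unary.All.Properties using (++⁺)
open import Data.Nat using (ℕ; _≤_; _^_; _∸_; _%_; _+_)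
open import Data.Nat.ListAction using (sum)
import Data.Nat.Properties as ℕP
open import Data.Product using (∃-syntax; _×_; _,_)
import Data.Sum as Sum
open import Relation.Binary.PropositionalEquality using (_≡_; _≢_; refl; sym; trans; cong)

corollary1 :
  (n : ℕ) → 2 ≤ n →
  (as : List ℕ) → length as + 1 ≡ n → All (1 ≤_) as →
  (bs : List ℕ) → (bk : ℕ) → All (1 ≤_) bs → 1 ≤ bk → bk ≢ 1 →
  mink as ≡ cf (bs ++ [ bk ]) →
  (s : ℕ) → 1 ≤ s →
  (cs : List ℕ) → 1 ≤ length cs → All (1 ≤_) cs →
  ∃[ z ] ∃[ rest ]
    (2 ^ (s + 1) ∸ 1 ≤ z × z ≤ 2 ^ (s + 2) ∸ 1 × All (1 ≤_) rest
    × (n % 2 ≡ (length bs + 1) % 2 →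
         mink (as ++ (sum as + s) ∷ cs)
           ≡ cf (bs ++ (bk ∸ 1) ∷ 1 ∷ z ∷ rest))
    × (n % 2 ≡ (length bs + 1 + 1) % 2 →
         mink (as ++ (sum as + s) ∷ cs)
           ≡ cf (bs ++ bk ∷ z ∷ rest)))
corollary1 n 2≤n as refl as⁺ bs bk bs⁺ 1≤bk bk≢1 x≡cf s _ cs 1≤|cs| cs⁺ =
  Sum.[ via-split-last , via-last ]′ (sign-cases₂ (length as) (length bs))
  where
  T = mink (as ++ (sum as + s) ∷ cs)
  Goal : Set
  Goal = ∃[ z ] ∃[ rest ] (2 ^ (s + 1) ∸ 1 ≤ z × z ≤ 2 ^ (s + 2) ∸ 1 × All (1 ≤_) rest
           × ((length as + 1) % 2 ≡ (length bs + 1) % 2 → T ≡ cf (bs ++ (bk ∸ 1) ∷ 1 ∷ z ∷ rest))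
           × ((length as + 1) % 2 ≡ (length bs + 1 + 1) % 2 → T ≡ cf (bs ++ bk ∷ z ∷ rest)))
  1≤|as| : 1 ≤ length as
  1≤|as| = ℕP.+-cancelʳ-≤ 1 1 (length as) 2≤n
  via-split-last : sign (length as) ≡ sign (length bs) → Goal
  via-split-last same =
    finish (mink-extension (split-last⁺ bs⁺ 1≤bk bk≢1) as⁺ 1≤|as| cs⁺ 1≤|cs|
                           (trans x≡cf (sym (cf-++-split-last bs 1≤bk)))
                           (trans same (sym (trans (cong sign (length-++ bs)) (sign-+2 (length bs))))) s)
    where
    finish : Extends (bs ++ (bk ∸ 1) ∷ [ 1 ]) s T → Goal
    finish (z , rest , lower , upper , rest⁺ , T≡) =
      z , rest , lower , upper , rest⁺ , (λ _ → trans T≡ (cong cf (++-assoc bs ((bk ∸ 1) ∷ [ 1 ]) (z ∷ rest)))) ,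
      λ parity → ⊥-elim (sign≡⇒sign-+1≢ {length as} {length bs} same
                   (trans (sign-cong-%2 (length as + 1) (length bs + 1 + 1) parity)
                          (trans (cong sign (ℕP.+-assoc (length bs) 1 1)) (sign-+2 (length bs)))))
  via-last : sign (length as) ≡ sign (length bs + 1) → Goal
  via-last opposite =
    finish (mink-extension (++⁺ bs⁺ (1≤bk ∷ [])) as⁺ 1≤|as| cs⁺ 1≤|cs| x≡cf
                           (trans opposite (sym (cong sign (length-++ bs)))) s)
    where
    finish : Extends (bs ++ [ bk ]) s T → Goal
    finish (z , rest , lower , upper , rest⁺ , T≡) =
      z , rest , lower , upper , rest⁺ ,
      (λ parity → ⊥-elim (sign≡⇒sign-+1≢ {length as} {length bs + 1} opposite
                            (sign-cong-%2 (length as + 1) (length bs + 1) parity))) ,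
      λ _ → trans T≡ (cong cf (++-assoc bs [ bk ] (z ∷ rest)))
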